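{- Let $G$ be a simple graph with $n$ vertices. The set $\{\rho\}\cup\{\delta(v)\mid v\in V(G)\}$ is linearly independent over $GF(2)$ unless $G$ is a complete graph, a star, or an edgeless graph. If $n>2$, then in each of these exceptional cases the rank of $\{\rho\}\cup\{\delta(v)\mid v\in V(G)\}$ is $n$.
   Context: These are vectors in the $GF(2)$-vector space of functions from ordered pairs $(x,y)$ of distinct vertices of $G$ to $GF(2)$. For $v\in V(G)$, $\delta(v)$ is the function with $\delta(v)(v,w)=1$ for all $w\neq v$, $\delta(v)(w,v)=1$ if $vw\in E(G)$, and $\delta(v)(x,y)=0$ otherwise; $\rho$ is the function with $\rho(v,w)=1$ for all $v\neq w$. A star is a complete bipartite graph $K_{1,n-1}$. -}

module Defs where

open import Data.Bool using (Bool; true; false; _xor_; _∧_; if_then_else_)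
open import Data.Nat using (ℕ; zero; suc; _+_; _≤_)
open import Data.Fin using (Fin; zero; suc; _≟_)
open import Data.Product using (Σ; ∃; _×_; _,_)
open import Data.Sum using (_⊎_)
open import Relation.Binary.PropositionalEquality using (_≡_; _≢_)
open import Relation.Nullary using (yes; no)
open import Function.Bundles using (_⇔_)

record SimpleGraph (n : ℕ) : Set where
  field
    adj   : Fin n → Fin n → Bool
    sym   : ∀ x y → adj x y ≡ adj y x
    irr   : ∀ x → adj x x ≡ false
open SimpleGraph public

-- Vectors: functions on ordered pairs (x , y) of vertices to GF(2) = Bool
-- (with xor as addition).  Only off-diagonal pairs x ≢ y are meaningful.
PairFun : ℕ → Set
PairFun n = Fin n → Fin n → Bool

IsZero : ∀ {n} → PairFun n → Set
IsZero {n} f = ∀ (x y : Fin n) → x ≢ y → f x y ≡ false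

ρ : ∀ {n} → PairFun n
ρ x y = true

δ : ∀ {n} → SimpleGraph n → Fin n → PairFun n
δ G v x y with x ≟ v
... | yes _ = true
... | no _ with y ≟ v
...   | yes _ = adj G v x
...   | no _ = false

family : ∀ {n} → SimpleGraph n → Fin (suc n) → PairFun n
family G zero = ρ
family G (suc v) = δ G v

comb : ∀ {m n} → (Fin m → Bool) → (Fin m → PairFun n) → PairFun n
comb {zero} c f x y = false
comb {suc m} c f x y =
  (c zero ∧ f zero x y) xor comb (λ i → c (suc i)) (λ i → f (suc i)) x y

LinIndep : ∀ {m n} → (Fin m → PairFun n) → Set
LinIndep {m} f = ∀ (c : Fin m → Bool) → IsZero (comb c f) → ∀ i → c i ≡ false

LinIndepSub : ∀ {m n} → (Fin m → PairFun n) → (Fin m → Bool) → Set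
LinIndepSub {m} f S =
  ∀ (c : Fin m → Bool) → (∀ i → c i ≡ true → S i ≡ true) →
  IsZero (comb c f) → ∀ i → c i ≡ false

count : ∀ {m} → (Fin m → Bool) → ℕ
count {zero} S = 0
count {suc m} S = (if S zero then 1 else 0) + count (λ i → S (suc i))

HasRank : ∀ {m n} → (Fin m → PairFun n) → ℕ → Set
HasRank {m} f r =
  (Σ (Fin m → Bool) λ S → count S ≡ r × LinIndepSub f S) ×
  (∀ (S : Fin m → Bool) → LinIndepSub f S → count S ≤ r)

IsComplete : ∀ {n} → SimpleGraph n → Set
IsComplete {n} G = ∀ (x y : Fin n) → x ≢ y → adj G x y ≡ true

IsEdgeless : ∀ {n} → SimpleGraph n → Set
IsEdgeless {n} G = ∀ (x y : Fin n) → adj G x y ≡ false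

IsStar : ∀ {n} → SimpleGraph n → Set
IsStar {n} G = Σ (Fin n) λ c →
  ∀ (x y : Fin n) → x ≢ y → (adj G x y ≡ true ⇔ (x ≡ c ⊎ y ≡ c))

Exceptional : ∀ {n} → SimpleGraph n → Set
Exceptional G = IsComplete G ⊎ IsStar G ⊎ IsEdgeless G

-- At an ordered pair (x , y) of distinct vertices the combination c₀ ρ + Σ_v c_v δ(v)
-- takes the value c₀ + c_x + c_y·[yx ∈ E], so it vanishes iff c_y·[yx ∈ E] = c₀ + c_x
-- for all such pairs.  If some c_v differs from c₀, then v is adjacent to every other
-- vertex and all other c_y equal 1; the graph is then complete (c₀ = 0) or a star
-- centred at v (c₀ = 1).  If every c_v equals c₀ = 1, the graph is edgeless.
-- Conversely each exceptional graph carries such a relation.  For n > 2 the family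
-- without δ(v₀) is independent for a suitable v₀: a relation with c_v₀ = 0 forces c_x = c₀
-- for x ≠ v₀, and then c₀ = 0 because v₀ has a non-neighbour or some edge avoids v₀.
module Submission where

open import Defs
open import Data.Bool using (Bool; true; false; not; _∧_; _xor_)
open import Data.Bool.Properties
  using (∧-zeroʳ; ∧-identityʳ; xor-assoc; xor-comm; xor-same; xor-identityʳ; ¬-not)
  renaming (_≟_ to _≟ᵇ_)
open import Data.Fin using (Fin; zero; suc; _≟_)
open import Data.Fin.Properties using (any?; suc-injective)
open import Data.Nat using (ℕ; zero; suc; _<_; _≤_; z≤n; s≤s)
open import Data.Nat.Properties using (m≤n⇒m≤1+n)
open import Data.Product using (∃; ∃₂; _×_; _,_; proj₁; proj₂)
open import Data.Sum using (_⊎_; inj₁; inj₂)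
open import Data.Vec.Functional using (_∷_)
open import Function using (_∘_; const)
open import Function.Bundles using (_⇔_; mk⇔; Equivalence)
open import Relation.Binary.PropositionalEquality as ≡
  using (_≡_; _≢_; refl; trans; cong; cong₂; subst; ≢-sym; module ≡-Reasoning)
open import Relation.Nullary using (¬_; yes; no; does; contradiction)

∧≡true : ∀ {a b} → a ∧ b ≡ true → a ≡ true × b ≡ true
∧≡true {true}  {true}  _ = refl , refl
∧≡true {true}  {false} ()
∧≡true {false}         ()

xor≡false⇔≡ : ∀ a b → a xor b ≡ false ⇔ b ≡ a
xor≡false⇔≡ false false = mk⇔ (const refl) (const refl)
xor≡false⇔≡ false true  = mk⇔ (λ ()) (λ ())
xor≡false⇔≡ true  false = mk⇔ (λ ()) (λ ())
xor≡false⇔≡ true  true  = mk⇔ (const refl) (const refl)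

comb-vanishing : ∀ {m n} (c : Fin m → Bool) (f : Fin m → PairFun n) (x y : Fin n) →
  (∀ i → c i ∧ f i x y ≡ false) → comb c f x y ≡ false
comb-vanishing {m = zero}  c f x y _ = refl
comb-vanishing {m = suc m} c f x y h rewrite h zero =
  comb-vanishing (c ∘ suc) (f ∘ suc) x y (h ∘ suc)

comb-single : ∀ {m n} (c : Fin m → Bool) (f : Fin m → PairFun n) (x y : Fin n) (k : Fin m) →
  (∀ i → i ≢ k → c i ∧ f i x y ≡ false) → comb c f x y ≡ c k ∧ f k x y
comb-single {m = suc m} c f x y zero h
  rewrite comb-vanishing (c ∘ suc) (f ∘ suc) x y (λ i → h (suc i) λ ()) =
    xor-identityʳ (c zero ∧ f zero x y)
comb-single {m = suc m} c f x y (suc k) h rewrite h zero (λ ()) =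
  comb-single (c ∘ suc) (f ∘ suc) x y k (λ i i≢k → h (suc i) (i≢k ∘ suc-injective))

comb-pair : ∀ {m n} (c : Fin m → Bool) (f : Fin m → PairFun n) (x y : Fin n) (k l : Fin m) →
  k ≢ l → (∀ i → i ≢ k → i ≢ l → c i ∧ f i x y ≡ false) →
  comb c f x y ≡ (c k ∧ f k x y) xor (c l ∧ f l x y)
comb-pair {m = suc m} c f x y zero zero k≢l _ = contradiction refl k≢l
comb-pair {m = suc m} c f x y zero (suc l) k≢l h =
  cong (c zero ∧ f zero x y xor_)
    (comb-single (c ∘ suc) (f ∘ suc) x y l (λ i i≢l → h (suc i) (λ ()) (i≢l ∘ suc-injective)))
comb-pair {m = suc m} c f x y (suc k) zero k≢l h =
  trans (cong (c zero ∧ f zero x y xor_)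
          (comb-single (c ∘ suc) (f ∘ suc) x y k (λ i i≢k → h (suc i) (i≢k ∘ suc-injective) (λ ()))))
        (xor-comm (c zero ∧ f zero x y) _)
comb-pair {m = suc m} c f x y (suc k) (suc l) k≢l h rewrite h zero (λ ()) (λ ()) =
  comb-pair (c ∘ suc) (f ∘ suc) x y k l (k≢l ∘ cong suc)
    (λ i i≢k i≢l → h (suc i) (i≢k ∘ suc-injective) (i≢l ∘ suc-injective))

module _ {n : ℕ} (G : SimpleGraph n) where

  δ-source : ∀ v y → δ G v v y ≡ true
  δ-source v y with v ≟ v
  ... | yes _  = refl
  ... | no v≢v = contradiction refl v≢v

  δ-target : ∀ v x → x ≢ v → δ G v x v ≡ adj G v x
  δ-target v x x≢v with x ≟ v
  ... | yes x≡v = contradiction x≡v x≢v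
  ... | no _ with v ≟ v
  ...   | yes _  = refl
  ...   | no v≢v = contradiction refl v≢v

  δ-elsewhere : ∀ v x y → x ≢ v → y ≢ v → δ G v x y ≡ false
  δ-elsewhere v x y x≢v y≢v with x ≟ v
  ... | yes x≡v = contradiction x≡v x≢v
  ... | no _ with y ≟ v
  ...   | yes y≡v = contradiction y≡v y≢v
  ...   | no _    = refl

  comb-family : (c : Fin (suc n) → Bool) (x y : Fin n) → x ≢ y →
    comb c (family G) x y ≡ (c zero xor c (suc x)) xor (c (suc y) ∧ adj G y x)
  comb-family c x y x≢y = begin
    (c zero ∧ true) xor comb (c ∘ suc) (δ G) x y
      ≡⟨ cong₂ _xor_ (∧-identityʳ (c zero)) (comb-pair (c ∘ suc) (δ G) x y x y x≢y off-pair) ⟩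
    c zero xor ((c (suc x) ∧ δ G x x y) xor (c (suc y) ∧ δ G y x y))
      ≡⟨ cong (c zero xor_) (cong₂ _xor_
           (trans (cong (c (suc x) ∧_) (δ-source x y)) (∧-identityʳ (c (suc x))))
           (cong (c (suc y) ∧_) (δ-target y x x≢y))) ⟩
    c zero xor (c (suc x) xor (c (suc y) ∧ adj G y x))
      ≡⟨ ≡.sym (xor-assoc (c zero) (c (suc x)) _) ⟩
    (c zero xor c (suc x)) xor (c (suc y) ∧ adj G y x) ∎
    where
    open ≡-Reasoning
    off-pair : ∀ v → v ≢ x → v ≢ y → c (suc v) ∧ δ G v x y ≡ false
    off-pair v v≢x v≢y =
      trans (cong (c (suc v) ∧_) (δ-elsewhere v x y (≢-sym v≢x) (≢-sym v≢y))) (∧-zeroʳ (c (suc v)))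

  LinearRelation : (Fin (suc n) → Bool) → Set
  LinearRelation c = ∀ x y → x ≢ y → c (suc y) ∧ adj G y x ≡ c zero xor c (suc x)

  isZero⇔linearRelation : ∀ c → IsZero (comb c (family G)) ⇔ LinearRelation c
  isZero⇔linearRelation c = mk⇔
    (λ z x y x≢y → Equivalence.to (xor≡false⇔≡ _ _) (trans (≡.sym (comb-family c x y x≢y)) (z x y x≢y)))
    (λ r x y x≢y → trans (comb-family c x y x≢y) (Equivalence.from (xor≡false⇔≡ _ _) (r x y x≢y)))

module _ {n : ℕ} (G : SimpleGraph n) (c : Fin (suc n) → Bool) (rel : LinearRelation G c) where

  adj-of-true : ∀ {x y} → x ≢ y → c (suc y) ≡ true → adj G y x ≡ c zero xor c (suc x)
  adj-of-true {x} {y} x≢y cy = subst (λ b → b ∧ adj G y x ≡ c zero xor c (suc x)) cy (rel x y x≢y)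

  dominating-of-differs : ∀ {v} → c zero xor c (suc v) ≡ true →
    ∀ y → y ≢ v → c (suc y) ≡ true × adj G y v ≡ true
  dominating-of-differs {v} differs y y≢v = ∧≡true (trans (rel v y (≢-sym y≢v)) differs)

  complete-of-relation : c zero ≡ false → (∀ u → c (suc u) ≡ true) → IsComplete G
  complete-of-relation c₀ all x y x≢y =
    trans (adj-of-true (≢-sym x≢y) (all x)) (cong₂ _xor_ c₀ (all y))

  edgeless-of-relation : c zero ≡ true → (∀ u → c (suc u) ≡ true) → IsEdgeless G
  edgeless-of-relation c₀ all x y with x ≟ y
  ... | yes refl = irr G x
  ... | no x≢y   = trans (adj-of-true (≢-sym x≢y) (all x)) (cong₂ _xor_ c₀ (all y))

  star-of-relation : c zero ≡ true → ∀ {v} → c zero xor c (suc v) ≡ true → IsStar G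
  star-of-relation c₀ {v} differs = v , λ x y x≢y → mk⇔ (centred x y x≢y) (spoke x y x≢y)
    where
    dominating : ∀ y → y ≢ v → c (suc y) ≡ true × adj G y v ≡ true
    dominating = dominating-of-differs differs
    centred : ∀ x y → x ≢ y → adj G x y ≡ true → x ≡ v ⊎ y ≡ v
    centred x y x≢y axy with x ≟ v | y ≟ v
    ... | yes x≡v | _       = inj₁ x≡v
    ... | no _    | yes y≡v = inj₂ y≡v
    ... | no x≢v  | no y≢v  with
      trans (≡.sym axy)
        (trans (adj-of-true (≢-sym x≢y) (proj₁ (dominating x x≢v)))
               (cong₂ _xor_ c₀ (proj₁ (dominating y y≢v))))
    ...   | ()
    spoke : ∀ x y → x ≢ y → x ≡ v ⊎ y ≡ v → adj G x y ≡ true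
    spoke x y x≢y (inj₁ refl) = trans (sym G x y) (proj₂ (dominating y (≢-sym x≢y)))
    spoke x y x≢y (inj₂ refl) = proj₂ (dominating x x≢y)

  exceptional-of-differs : ∀ {v} → c zero xor c (suc v) ≡ true → Exceptional G
  exceptional-of-differs {v} differs with c zero ≟ᵇ true
  ... | yes c₀    = inj₂ (inj₁ (star-of-relation c₀ differs))
  ... | no c₀≢true = inj₁ (complete-of-relation c₀ all)
    where
    c₀ : c zero ≡ false
    c₀ = ¬-not c₀≢true
    all : ∀ u → c (suc u) ≡ true
    all u with u ≟ v
    ... | yes refl = trans (≡.sym (cong (_xor c (suc u)) c₀)) differs
    ... | no u≢v   = proj₁ (dominating-of-differs differs u u≢v)

  edgeless-of-constant : (∀ u → c (suc u) ≡ c zero) → ∀ i → c i ≡ true → IsEdgeless G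
  edgeless-of-constant constant zero c₀ = edgeless-of-relation c₀ (λ u → trans (constant u) c₀)
  edgeless-of-constant constant (suc u) cu =
    edgeless-of-constant constant zero (trans (≡.sym (constant u)) cu)

  exceptional-of-relation : ∀ i → c i ≡ true → Exceptional G
  exceptional-of-relation i ci with any? (λ v → c zero xor c (suc v) ≟ᵇ true)
  ... | yes (v , differs) = exceptional-of-differs differs
  ... | no none = inj₂ (inj₂ (edgeless-of-constant constant i ci))
    where
    constant : ∀ u → c (suc u) ≡ c zero
    constant u = Equivalence.to (xor≡false⇔≡ _ _) (¬-not (none ∘ (u ,_)))

  module _ {v₀ : Fin n} (cv₀ : c (suc v₀) ≡ false) where

    constant-off : ∀ x → x ≢ v₀ → c (suc x) ≡ c zero
    constant-off x x≢v₀ =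
      Equivalence.to (xor≡false⇔≡ _ _) (trans (≡.sym (rel x v₀ x≢v₀)) (cong (_∧ adj G v₀ x) cv₀))

    c₀≡false-of-nonneighbour : ∀ {w} → w ≢ v₀ → adj G w v₀ ≡ false → c zero ≡ false
    c₀≡false-of-nonneighbour {w} w≢v₀ awv₀ = begin
      c zero                   ≡⟨ ≡.sym (xor-identityʳ (c zero)) ⟩
      c zero xor false         ≡⟨ cong (c zero xor_) (≡.sym cv₀) ⟩
      c zero xor c (suc v₀)    ≡⟨ ≡.sym (rel v₀ w (≢-sym w≢v₀)) ⟩
      c (suc w) ∧ adj G w v₀   ≡⟨ cong (c (suc w) ∧_) awv₀ ⟩
      c (suc w) ∧ false        ≡⟨ ∧-zeroʳ (c (suc w)) ⟩
      false                    ∎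
      where open ≡-Reasoning

    c₀≡false-of-edge-avoiding : ∀ {x y} → x ≢ y → x ≢ v₀ → y ≢ v₀ → adj G y x ≡ true →
      c zero ≡ false
    c₀≡false-of-edge-avoiding {x} {y} x≢y x≢v₀ y≢v₀ ayx = begin
      c zero                   ≡⟨ ≡.sym (constant-off y y≢v₀) ⟩
      c (suc y)                ≡⟨ ≡.sym (∧-identityʳ (c (suc y))) ⟩
      c (suc y) ∧ true         ≡⟨ cong (c (suc y) ∧_) (≡.sym ayx) ⟩
      c (suc y) ∧ adj G y x    ≡⟨ rel x y x≢y ⟩
      c zero xor c (suc x)     ≡⟨ cong (c zero xor_) (constant-off x x≢v₀) ⟩
      c zero xor c zero        ≡⟨ xor-same (c zero) ⟩
      false                    ∎
      where open ≡-Reasoning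

    trivial-of-c₀≡false : c zero ≡ false → ∀ i → c i ≡ false
    trivial-of-c₀≡false c₀ zero = c₀
    trivial-of-c₀≡false c₀ (suc x) with x ≟ v₀
    ... | yes refl = cv₀
    ... | no x≢v₀  = trans (constant-off x x≢v₀) c₀

allBut : ∀ {m} → Fin m → Fin m → Bool
allBut k i = not (does (i ≟ k))

allBut-self : ∀ {m} (k : Fin m) → allBut k k ≡ false
allBut-self k with k ≟ k
... | yes _  = refl
... | no k≢k = contradiction refl k≢k

allBut-other : ∀ {m} (k i : Fin m) → i ≢ k → allBut k i ≡ true
allBut-other k i i≢k with i ≟ k
... | yes i≡k = contradiction i≡k i≢k
... | no _    = refl

count-all : ∀ {m} (S : Fin m → Bool) → (∀ i → S i ≡ true) → count S ≡ m
count-all {zero}  S h = refl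
count-all {suc m} S h rewrite h zero = cong suc (count-all (S ∘ suc) (h ∘ suc))

count-except : ∀ {m} (S : Fin (suc m) → Bool) k → S k ≡ false → (∀ i → i ≢ k → S i ≡ true) →
  count S ≡ m
count-except S zero Sk h rewrite Sk = count-all (S ∘ suc) (λ i → h (suc i) λ ())
count-except {suc m} S (suc k) Sk h rewrite h zero (λ ()) =
  cong suc (count-except (S ∘ suc) k Sk (λ i i≢k → h (suc i) (i≢k ∘ suc-injective)))

count-allBut : ∀ {m} (k : Fin (suc m)) → count (allBut k) ≡ m
count-allBut k = count-except (allBut k) k (allBut-self k) (allBut-other k)

count≤ : ∀ {m} (S : Fin m → Bool) → count S ≤ m
count≤ {zero}  S = z≤n
count≤ {suc m} S with S zero
... | true  = s≤s (count≤ (S ∘ suc))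
... | false = m≤n⇒m≤1+n (count≤ (S ∘ suc))

count≤-of-false : ∀ {m} (S : Fin (suc m) → Bool) k → S k ≡ false → count S ≤ m
count≤-of-false S zero Sk rewrite Sk = count≤ (S ∘ suc)
count≤-of-false {suc m} S (suc k) Sk with S zero
... | true  = s≤s (count≤-of-false (S ∘ suc) k Sk)
... | false = m≤n⇒m≤1+n (count≤-of-false (S ∘ suc) k Sk)

module _ {m n : ℕ} (f : Fin (suc m) → PairFun n) where

  linIndepSub-allBut : ∀ k → (∀ c → IsZero (comb c f) → c k ≡ false → ∀ i → c i ≡ false) →
    LinIndepSub f (allBut k)
  linIndepSub-allBut k indep c supported z = indep c z ck
    where
    ck : c k ≡ false
    ck with c k in eq
    ... | false = refl
    ... | true with trans (≡.sym (supported k eq)) (allBut-self k)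
    ...   | ()

  hasRank-of-dependent : ∀ k → LinIndepSub f (allBut k) → ¬ LinIndep f → HasRank f m
  hasRank-of-dependent k indep dep = (allBut k , count-allBut k , indep) , bounded
    where
    bounded : ∀ S → LinIndepSub f S → count S ≤ m
    bounded S indepS with any? (λ i → S i ≟ᵇ false)
    ... | yes (i , Si) = count≤-of-false S i Si
    ... | no none = contradiction (λ c → indepS c (λ i _ → ¬-not (none ∘ (i ,_)))) dep

module _ {n : ℕ} {G : SimpleGraph n} where

  nonexceptional⇒linIndep : ¬ Exceptional G → LinIndep (family G)
  nonexceptional⇒linIndep nexc c z i with c i in ci
  ... | false = refl
  ... | true  = contradiction
    (exceptional-of-relation G c (Equivalence.to (isZero⇔linearRelation G c) z) i ci) nexc

  dependent-of-relation : ∀ c i → LinearRelation G c → c i ≡ true → ¬ LinIndep (family G)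
  dependent-of-relation c i rel ci indep with
    trans (≡.sym ci) (indep c (Equivalence.from (isZero⇔linearRelation G c) rel) i)
  ... | ()

  exceptional⇒dependent : Fin n → Exceptional G → ¬ LinIndep (family G)
  exceptional⇒dependent v (inj₁ complete) =
    dependent-of-relation (false ∷ const true) (suc v)
      (λ x y x≢y → complete y x (≢-sym x≢y)) refl
  exceptional⇒dependent _ (inj₂ (inj₂ edgeless)) =
    dependent-of-relation (const true) zero (λ x y _ → edgeless y x) refl
  exceptional⇒dependent _ (inj₂ (inj₁ (s , star))) =
    dependent-of-relation (true ∷ allBut s) zero relation refl
    where
    relation : LinearRelation G (true ∷ allBut s)
    relation x y x≢y with x ≟ s | y ≟ s
    ... | yes refl | yes refl = contradiction refl x≢y
    ... | yes refl | no y≢s   = Equivalence.from (star y x (≢-sym x≢y)) (inj₂ refl)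
    ... | no _     | yes _    = refl
    ... | no x≢s   | no y≢s   with adj G y x in ayx
    ...   | false = refl
    ...   | true with Equivalence.to (star y x (≢-sym x≢y)) ayx
    ...     | inj₁ y≡s = contradiction y≡s y≢s
    ...     | inj₂ x≡s = contradiction x≡s x≢s

  Removable : Fin n → Set
  Removable v₀ = LinIndepSub (family G) (allBut (suc v₀))

  removable-of-nonneighbour : ∀ {v₀ w} → w ≢ v₀ → adj G w v₀ ≡ false → Removable v₀
  removable-of-nonneighbour w≢v₀ awv₀ = linIndepSub-allBut (family G) _ λ c z cv₀ →
    let rel = Equivalence.to (isZero⇔linearRelation G c) z in
    trivial-of-c₀≡false G c rel cv₀ (c₀≡false-of-nonneighbour G c rel cv₀ w≢v₀ awv₀)

  removable-of-edge-avoiding : ∀ {v₀ x y} → x ≢ y → x ≢ v₀ → y ≢ v₀ → adj G y x ≡ true →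
    Removable v₀
  removable-of-edge-avoiding x≢y x≢v₀ y≢v₀ ayx = linIndepSub-allBut (family G) _ λ c z cv₀ →
    let rel = Equivalence.to (isZero⇔linearRelation G c) z in
    trivial-of-c₀≡false G c rel cv₀ (c₀≡false-of-edge-avoiding G c rel cv₀ x≢y x≢v₀ y≢v₀ ayx)

two-others : ∀ {n} → 2 < n → (s : Fin n) → ∃₂ λ u v → u ≢ s × v ≢ s × v ≢ u
two-others (s≤s (s≤s (s≤s _))) zero          = suc zero , suc (suc zero) , (λ ()) , (λ ()) , (λ ())
two-others (s≤s (s≤s (s≤s _))) (suc zero)    = zero , suc (suc zero) , (λ ()) , (λ ()) , (λ ())
two-others (s≤s (s≤s (s≤s _))) (suc (suc _)) = zero , suc zero , (λ ()) , (λ ()) , (λ ())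

exceptional⇒removable : ∀ {n} {G : SimpleGraph n} → 2 < n → Exceptional G → ∃ (Removable {G = G})
exceptional⇒removable (s≤s (s≤s (s≤s _))) (inj₁ complete) =
  zero , removable-of-edge-avoiding {x = suc zero} {y = suc (suc zero)} (λ ()) (λ ()) (λ ())
           (complete _ _ λ ())
exceptional⇒removable (s≤s (s≤s (s≤s _))) (inj₂ (inj₂ edgeless)) =
  zero , removable-of-nonneighbour {w = suc zero} (λ ()) (edgeless _ _)
exceptional⇒removable 2<n (inj₂ (inj₁ (s , star))) with two-others 2<n s
... | v₀ , w , v₀≢s , w≢s , w≢v₀ =
  v₀ , removable-of-edge-avoiding (≢-sym w≢s) (≢-sym v₀≢s) w≢v₀
         (Equivalence.from (star w s w≢s) (inj₂ refl))

proposition10 : ∀ (n : ℕ) (G : SimpleGraph n) →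
    (¬ Exceptional G → LinIndep (family G)) ×
    (2 < n → Exceptional G → HasRank (family G) n)
proposition10 n G = nonexceptional⇒linIndep , hasRank-of-exceptional
  where
  hasRank-of-exceptional : 2 < n → Exceptional G → HasRank (family G) n
  hasRank-of-exceptional 2<n exc with exceptional⇒removable 2<n exc
  ... | v₀ , removable =
    hasRank-of-dependent (family G) (suc v₀) removable (exceptional⇒dependent v₀ exc)
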